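{- Let $m$ be a positive integer and let $L$ be a list assignment on a path $P=v_1\cdots v_n$ with $n$ odd and $|L(v_i)|=4m$ for all $i$. Then \[ S_L(P)\ge 2nm-2m+|\hat X_1|+|\hat X_n|+|A|. \]
   Context: $X_1=L(v_1)$, $X_i=L(v_i)\setminus X_{i-1}$ for $i>1$, $S_L(P)=\sum_{i=1}^n|X_i|$. $A=\bigcap_{i=1}^n L(v_i)$. For $c\in L(v_1)\setminus A$, $f(c)=\min\{i: c\notin L(v_i)\}$; $\hat X_1=\{c\in L(v_1)\setminus A: f(c)\text{ even}\}$; $\hat X_n=X_n\setminus A$. -}

module Defs where

open import Data.Nat using (ℕ; zero; suc; _+_; _%_)
open import Data.Bool using (Bool; true; false; if_then_else_; _∧_; not)
open import Data.Fin using (Fin)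
open import Data.Vec using (lookup; tabulate)
open import Data.Fin.Subset using (Subset; _∩_; _─_; ⊤; ⊥; ∣_∣)

-- A list assignment on the path P = v₁ ⋯ vₙ is modelled as L : ℕ → Subset k,
-- where L i is the list L(vᵢ) (only indices 1 ≤ i ≤ n are relevant), and the
-- colours are drawn from the finite universe Fin k.

X : ∀ {k} → (ℕ → Subset k) → ℕ → Subset k
X L zero = ⊥
X L (suc zero) = L 1
X L (suc (suc i)) = L (suc (suc i)) ─ X L (suc i)

sumX : ∀ {k} → (ℕ → Subset k) → ℕ → ℕ
sumX L zero = 0
sumX L (suc j) = sumX L j + ∣ X L (suc j) ∣

S : ∀ {k} → (ℕ → Subset k) → ℕ → ℕ
S L n = sumX L n

interL : ∀ {k} → (ℕ → Subset k) → ℕ → Subset k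
interL L zero = ⊤
interL L (suc j) = interL L j ∩ L (suc j)

A : ∀ {k} → (ℕ → Subset k) → ℕ → Subset k
A L n = interL L n

fAux : ∀ {k} → (ℕ → Subset k) → Fin k → ℕ → ℕ → ℕ
fAux L c i zero = i
fAux L c i (suc r) = if lookup (L i) c then fAux L c (suc i) r else i

-- f(c) = min { i ∈ [1,n] : c ∉ L(vᵢ) }  (meaningful for c ∈ L(v₁) ∖ A)
f : ∀ {k} → (ℕ → Subset k) → ℕ → Fin k → ℕ
f L n c = fAux L c 1 n

isEven : ℕ → Bool
isEven m with m % 2
... | zero = true
... | suc _ = false

hatX1 : ∀ {k} → (ℕ → Subset k) → ℕ → Subset k
hatX1 L n = tabulate λ c → lookup (L 1 ─ A L n) c ∧ isEven (f L n c)

hatXn : ∀ {k} → (ℕ → Subset k) → ℕ → Subset k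
hatXn L n = X L n ─ A L n

-- The bound holds colour by colour.  Fix a colour c and write c ∈ Xᵢ for
-- "c is new at vᵢ".  Every even i with c ∈ L(vᵢ) is paid for by c ∈ Xᵢ, or else by
-- c ∈ Xᵢ₋₁; in the second case nothing is lost, and whenever c ∈ X₂ₛ₊₁ but
-- c ∉ L(v₂ₛ₊₂) (a handover) one unit of slack is gained.  Hence
--   #{even i : c ∈ L(vᵢ)} + [c ∈ Xₙ] + #handovers ≤ #{i : c ∈ Xᵢ}.
-- The indicators of A and X̂ₙ are disjoint and both below [c ∈ Xₙ], while c ∈ X̂₁
-- forces a handover just before the even index f(c).  Summing over colours, the
-- even lists contribute ((n - 1) / 2) · 4m = 2nm - 2m.
module Submission where

open import Defs
open import Data.Bool using (Bool; true; false; _∧_; if_then_else_)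
open import Data.Fin using (zero; suc)
open import Data.Fin.Subset using (Subset; ∣_∣; _─_; _∩_)
open import Data.Nat using (ℕ; zero; suc; _+_; _*_; _∸_; _≤_; _%_; z≤n; s≤s)
open import Data.Nat.Properties
open import Algebra.Properties.CommutativeSemigroup +-commutativeSemigroup using (interchange)
open import Data.Nat.Tactic.RingSolver using (solve-∀)
open import Data.Product using (∃; _,_)
open import Data.Vec using (Vec; []; _∷_; tail; lookup; zipWith)
open import Data.Vec.Properties using (tabulate-cong; lookup-zipWith)
open import Relation.Binary.PropositionalEquality

bit : Bool → ℕ
bit true  = 1
bit false = 0

-- Mirrors the pointwise operation of _─_, so that heads of differences compute.
_∖ᵇ_ : Bool → Bool → Bool
x ∖ᵇ true  = false
x ∖ᵇ false = x

bit-exchange : ∀ a b → bit b + bit (a ∖ᵇ b) ≡ bit a + bit (b ∖ᵇ a)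
bit-exchange true  true  = refl
bit-exchange true  false = refl
bit-exchange false true  = refl
bit-exchange false false = refl

double : ℕ → ℕ
double zero    = zero
double (suc t) = suc (suc (double t))

odd : ℕ → ℕ
odd t = suc (double t)

isEven-odd : ∀ t → isEven (odd t) ≡ false
isEven-odd zero    = refl
isEven-odd (suc t) = isEven-odd t

-- l i records whether a fixed colour lies in L(vᵢ); new, inAll, firstMiss, hat₁
-- and hatₙ are the one-colour versions of X, interL, fAux, hatX1 and hatXn.
module Lane (l : ℕ → Bool) where

  new : ℕ → Bool
  new zero          = false
  new (suc zero)    = l 1
  new (suc (suc i)) = l (suc (suc i)) ∖ᵇ new (suc i)

  newCount : ℕ → ℕ
  newCount zero    = 0
  newCount (suc i) = newCount i + bit (new (suc i))

  inAll : ℕ → Bool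
  inAll zero    = true
  inAll (suc i) = inAll i ∧ l (suc i)

  firstMiss : ℕ → ℕ → ℕ
  firstMiss i zero    = i
  firstMiss i (suc r) = if l i then firstMiss (suc i) r else i

  hat₁ : ℕ → Bool
  hat₁ n = (l 1 ∖ᵇ inAll n) ∧ isEven (firstMiss 1 n)

  hatₙ : ℕ → Bool
  hatₙ n = new n ∖ᵇ inAll n

  evenCount : ℕ → ℕ
  evenCount zero    = 0
  evenCount (suc s) = evenCount s + bit (l (2 + double s))

  handover : ℕ → Bool
  handover s = new (odd s) ∖ᵇ l (2 + double s)

  handovers : ℕ → ℕ
  handovers zero    = 0
  handovers (suc s) = handovers s + bit (handover s)

  handovers-mono : ∀ {s} d → handovers s ≤ handovers (s + d)
  handovers-mono {s} zero    rewrite +-identityʳ s = ≤-refl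
  handovers-mono {s} (suc d) rewrite +-suc s d     = ≤-trans (handovers-mono {s} d) (m≤m+n _ _)

  newCount-bound : ∀ t → evenCount t + bit (new (odd t)) + handovers t ≤ newCount (odd t)
  newCount-bound zero    = ≤-reflexive (+-identityʳ (bit (l 1)))
  newCount-bound (suc t) = begin
    evenCount t + bit b + y + (handovers t + bit (a ∖ᵇ b))  ≡⟨ shuffle₁ (evenCount t) (handovers t) y (bit b) (bit (a ∖ᵇ b)) ⟩
    evenCount t + handovers t + y + (bit b + bit (a ∖ᵇ b))  ≡⟨ cong (evenCount t + handovers t + y +_) (bit-exchange a b) ⟩
    evenCount t + handovers t + y + (bit a + bit (b ∖ᵇ a))  ≡⟨ shuffle₂ (evenCount t) (handovers t) y (bit a) (bit (b ∖ᵇ a)) ⟩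
    evenCount t + bit a + handovers t + bit (b ∖ᵇ a) + y    ≤⟨ +-monoˡ-≤ y (+-monoˡ-≤ (bit (b ∖ᵇ a)) (newCount-bound t)) ⟩
    newCount (odd t) + bit (b ∖ᵇ a) + y                     ∎
    where
    open ≤-Reasoning
    a = new (odd t)
    b = l (2 + double t)
    y = bit (new (3 + double t))
    shuffle₁ : ∀ e c y p q → e + p + y + (c + q) ≡ e + c + y + (p + q)
    shuffle₁ = solve-∀
    shuffle₂ : ∀ e c y p q → e + c + y + (p + q) ≡ e + p + c + q + y
    shuffle₂ = solve-∀

  inAll⇒new : ∀ t → inAll (odd t) ≡ true → new (odd t) ≡ true
  inAll⇒new zero    all = all
  inAll⇒new (suc t) all with inAll (odd t) in all′ | l (2 + double t) | l (3 + double t) | all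
  ... | true | true | true | _ rewrite inAll⇒new t all′ = refl

  -- Without the hypothesis on inAll (odd (s + d)) the search could run out of
  -- budget, and firstMiss then returns an even index although no list misses c.
  handover-before-evenMiss : ∀ d s → inAll (odd s) ≡ true → inAll (odd (s + d)) ≡ false →
                             isEven (firstMiss (2 + double s) (double d)) ≡ true → 1 ≤ handovers (s + d)
  handover-before-evenMiss zero s all notAll _
    rewrite +-identityʳ s with () ← trans (sym all) notAll
  handover-before-evenMiss (suc d) s all notAll even with l (2 + double s) in lₑ
  ... | false = begin
    1                      ≡⟨ sym (cong₂ (λ x y → bit (x ∖ᵇ y)) (inAll⇒new s all) lₑ) ⟩
    bit (handover s)       ≤⟨ m≤n+m _ _ ⟩
    handovers (suc s)      ≤⟨ handovers-mono {suc s} d ⟩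
    handovers (suc s + d)  ≡⟨ cong handovers (sym (+-suc s d)) ⟩
    handovers (s + suc d)  ∎
    where open ≤-Reasoning
  ... | true with l (3 + double s) in lₒ
  ...   | false with () ← trans (sym even) (isEven-odd (suc s))
  ...   | true rewrite +-suc s d =
    handover-before-evenMiss d (suc s) (cong₂ _∧_ (cong₂ _∧_ all lₑ) lₒ) notAll even

  evenMiss⇒handover : ∀ t → inAll (odd t) ≡ false → bit (l 1 ∧ isEven (firstMiss 1 (odd t))) ≤ handovers t
  evenMiss⇒handover t notAll with l 1 in l₁
  ... | false = z≤n
  ... | true with isEven (firstMiss 2 (double t)) in even
  ...   | false = z≤n
  ...   | true  = handover-before-evenMiss t 0 l₁ notAll even

  hats-bound : ∀ t → bit (hat₁ (odd t)) + bit (hatₙ (odd t)) + bit (inAll (odd t)) ≤ bit (new (odd t)) + handovers t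
  hats-bound t = cases (inAll (odd t)) refl
    where
    cases : ∀ b → inAll (odd t) ≡ b →
            bit ((l 1 ∖ᵇ b) ∧ isEven (firstMiss 1 (odd t))) + bit (new (odd t) ∖ᵇ b) + bit b ≤ bit (new (odd t)) + handovers t
    cases true  all    rewrite inAll⇒new t all = s≤s z≤n
    cases false notAll = begin
      h₁ + bit (new (odd t)) + 0    ≡⟨ +-identityʳ _ ⟩
      h₁ + bit (new (odd t))        ≡⟨ +-comm h₁ _ ⟩
      bit (new (odd t)) + h₁        ≤⟨ +-monoʳ-≤ _ (evenMiss⇒handover t notAll) ⟩
      bit (new (odd t)) + handovers t  ∎
      where
      open ≤-Reasoning
      h₁ = bit (l 1 ∧ isEven (firstMiss 1 (odd t)))

  lane-bound : ∀ t → evenCount t + bit (hat₁ (odd t)) + bit (hatₙ (odd t)) + bit (inAll (odd t)) ≤ newCount (odd t)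
  lane-bound t = begin
    evenCount t + h₁ + hₙ + a        ≡⟨ +-assoc-4 (evenCount t) h₁ hₙ a ⟩
    evenCount t + (h₁ + hₙ + a)      ≤⟨ +-monoʳ-≤ (evenCount t) (hats-bound t) ⟩
    evenCount t + (bit (new (odd t)) + handovers t)  ≡⟨ sym (+-assoc (evenCount t) _ _) ⟩
    evenCount t + bit (new (odd t)) + handovers t    ≤⟨ newCount-bound t ⟩
    newCount (odd t)                 ∎
    where
    open ≤-Reasoning
    h₁ = bit (hat₁ (odd t))
    hₙ = bit (hatₙ (odd t))
    a  = bit (inAll (odd t))
    +-assoc-4 : ∀ w x y z → w + x + y + z ≡ w + (x + y + z)
    +-assoc-4 = solve-∀

∣∣-head-tail : ∀ {k} (p : Subset (suc k)) → ∣ p ∣ ≡ bit (lookup p zero) + ∣ tail p ∣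
∣∣-head-tail (true  ∷ p) = refl
∣∣-head-tail (false ∷ p) = refl

∣∣-Subset0 : (p : Subset 0) → ∣ p ∣ ≡ 0
∣∣-Subset0 [] = refl

head-─ : ∀ {k} (p q : Subset (suc k)) → lookup (p ─ q) zero ≡ lookup p zero ∖ᵇ lookup q zero
head-─ (x ∷ p) (true  ∷ q) = refl
head-─ (x ∷ p) (false ∷ q) = refl

tail-zipWith : ∀ {A B C : Set} (f : A → B → C) {k} (xs : Vec A (suc k)) (ys : Vec B (suc k)) →
               tail (zipWith f xs ys) ≡ zipWith f (tail xs) (tail ys)
tail-zipWith f (x ∷ xs) (y ∷ ys) = refl

tail-─ : ∀ {k} (p q : Subset (suc k)) → tail (p ─ q) ≡ tail p ─ tail q
tail-─ (x ∷ p) (y ∷ q) = refl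

lookup-suc : ∀ {A : Set} {k} (xs : Vec A (suc k)) i → lookup xs (suc i) ≡ lookup (tail xs) i
lookup-suc (x ∷ xs) i = refl

evenSizes : ∀ {k} → (ℕ → Subset k) → ℕ → ℕ
evenSizes L zero    = 0
evenSizes L (suc s) = evenSizes L s + ∣ L (2 + double s) ∣

module Colourwise {k : ℕ} (L : ℕ → Subset (suc k)) where

  first : ℕ → Bool
  first i = lookup (L i) zero

  rest : ℕ → Subset k
  rest i = tail (L i)

  open Lane first

  X-first : ∀ i → lookup (X L i) zero ≡ new i
  X-first zero          = refl
  X-first (suc zero)    = refl
  X-first (suc (suc i)) = trans (head-─ (L (2 + i)) (X L (suc i))) (cong (first (2 + i) ∖ᵇ_) (X-first (suc i)))

  X-rest : ∀ i → tail (X L i) ≡ X rest i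
  X-rest zero          = refl
  X-rest (suc zero)    = refl
  X-rest (suc (suc i)) = trans (tail-─ (L (2 + i)) (X L (suc i))) (cong (rest (2 + i) ─_) (X-rest (suc i)))

  interL-first : ∀ i → lookup (interL L i) zero ≡ inAll i
  interL-first zero    = refl
  interL-first (suc i) = trans (lookup-zipWith _∧_ zero (interL L i) (L (suc i))) (cong (_∧ first (suc i)) (interL-first i))

  interL-rest : ∀ i → tail (interL L i) ≡ interL rest i
  interL-rest zero    = refl
  interL-rest (suc i) = trans (tail-zipWith _∧_ (interL L i) (L (suc i))) (cong (_∩ rest (suc i)) (interL-rest i))

  fAux-first : ∀ i r → fAux L zero i r ≡ firstMiss i r
  fAux-first i zero    = refl
  fAux-first i (suc r) rewrite fAux-first (suc i) r = refl

  fAux-rest : ∀ c i r → fAux L (suc c) i r ≡ fAux rest c i r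
  fAux-rest c i zero    = refl
  fAux-rest c i (suc r) rewrite fAux-rest c (suc i) r | lookup-suc (L i) c = refl

  S-split : ∀ n → S L n ≡ newCount n + S rest n
  S-split zero    = refl
  S-split (suc n) rewrite ∣∣-head-tail (X L (suc n)) | S-split n | X-first (suc n) | X-rest (suc n) =
    interchange (newCount n) (S rest n) (bit (new (suc n))) ∣ X rest (suc n) ∣

  evenSizes-split : ∀ t → evenSizes L t ≡ evenCount t + evenSizes rest t
  evenSizes-split zero    = refl
  evenSizes-split (suc t) rewrite ∣∣-head-tail (L (2 + double t)) | evenSizes-split t =
    interchange (evenCount t) (evenSizes rest t) (bit (first (2 + double t))) ∣ rest (2 + double t) ∣

  A-split : ∀ n → ∣ A L n ∣ ≡ bit (inAll n) + ∣ A rest n ∣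
  A-split n rewrite ∣∣-head-tail (interL L n) | interL-first n | interL-rest n = refl

  hatXn-split : ∀ n → ∣ hatXn L n ∣ ≡ bit (hatₙ n) + ∣ hatXn rest n ∣
  hatXn-split n rewrite ∣∣-head-tail (X L n ─ interL L n) | head-─ (X L n) (interL L n) | tail-─ (X L n) (interL L n)
    | X-first n | X-rest n | interL-first n | interL-rest n = refl

  hatX1-split : ∀ n → ∣ hatX1 L n ∣ ≡ bit (hat₁ n) + ∣ hatX1 rest n ∣
  hatX1-split n = trans (∣∣-head-tail (hatX1 L n)) (cong₂ _+_ (cong bit head-hat) (cong ∣_∣ (tabulate-cong tail-hat)))
    where
    head-hat : lookup (L 1 ─ interL L n) zero ∧ isEven (fAux L zero 1 n) ≡ hat₁ n
    head-hat rewrite head-─ (L 1) (interL L n) | interL-first n | fAux-first 1 n = refl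
    tail-hat : ∀ c → lookup (L 1 ─ interL L n) (suc c) ∧ isEven (fAux L (suc c) 1 n)
                   ≡ lookup (rest 1 ─ interL rest n) c ∧ isEven (fAux rest c 1 n)
    tail-hat c rewrite lookup-suc (L 1 ─ interL L n) c | tail-─ (L 1) (interL L n) | interL-rest n | fAux-rest c 1 n = refl

evenSizes-Subset0 : (L : ℕ → Subset 0) (t : ℕ) → evenSizes L t ≡ 0
evenSizes-Subset0 L zero    = refl
evenSizes-Subset0 L (suc t) rewrite evenSizes-Subset0 L t | ∣∣-Subset0 (L (2 + double t)) = refl

evenSizes+hats≤S : ∀ k (L : ℕ → Subset k) t →
  evenSizes L t + ∣ hatX1 L (odd t) ∣ + ∣ hatXn L (odd t) ∣ + ∣ A L (odd t) ∣ ≤ S L (odd t)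
evenSizes+hats≤S zero L t
  rewrite evenSizes-Subset0 L t | ∣∣-Subset0 (hatXn L (odd t)) | ∣∣-Subset0 (A L (odd t)) = z≤n
evenSizes+hats≤S (suc k) L t
  rewrite Colourwise.evenSizes-split L t | Colourwise.hatX1-split L (odd t) | Colourwise.hatXn-split L (odd t)
        | Colourwise.A-split L (odd t) | Colourwise.S-split L (odd t) = begin
    (evenCount t + evenSizes rest t) + (bit (hat₁ n) + ∣ hatX1 rest n ∣)
      + (bit (hatₙ n) + ∣ hatXn rest n ∣) + (bit (inAll n) + ∣ A rest n ∣)
      ≡⟨ regroup (evenCount t) (evenSizes rest t) (bit (hat₁ n)) (∣ hatX1 rest n ∣)
                 (bit (hatₙ n)) (∣ hatXn rest n ∣) (bit (inAll n)) (∣ A rest n ∣) ⟩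
    (evenCount t + bit (hat₁ n) + bit (hatₙ n) + bit (inAll n))
      + (evenSizes rest t + ∣ hatX1 rest n ∣ + ∣ hatXn rest n ∣ + ∣ A rest n ∣)
      ≤⟨ +-mono-≤ (lane-bound t) (evenSizes+hats≤S k rest t) ⟩
    newCount n + S rest n  ∎
  where
  open Colourwise L
  open Lane first
  open ≤-Reasoning
  n = odd t
  regroup : ∀ a a′ b b′ c c′ d d′ → (a + a′) + (b + b′) + (c + c′) + (d + d′) ≡ (a + b + c + d) + (a′ + b′ + c′ + d′)
  regroup = solve-∀

evenSizes-const : ∀ {k} (L : ℕ → Subset k) {c} t → (∀ i → 1 ≤ i → i ≤ odd t → ∣ L i ∣ ≡ c) → evenSizes L t ≡ t * c
evenSizes-const L zero    sizes = refl
evenSizes-const L {c} (suc t) sizes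
  rewrite evenSizes-const L t (λ i 1≤i i≤ → sizes i 1≤i (m≤n⇒m≤o+n 2 i≤))
        | sizes (2 + double t) (s≤s z≤n) (n≤1+n _) = +-comm (t * c) c

%2≡1⇒odd : ∀ n → n % 2 ≡ 1 → ∃ λ t → n ≡ odd t
%2≡1⇒odd (suc zero)    _      = zero , refl
%2≡1⇒odd (suc (suc n)) n-odd with %2≡1⇒odd n n-odd
... | t , refl = suc t , refl

double≡2* : ∀ t → double t ≡ 2 * t
double≡2* zero    = refl
double≡2* (suc t) = cong suc (trans (cong suc (double≡2* t)) (sym (+-suc t (t + 0))))

2*odd*m∸2*m : ∀ m t → 2 * odd t * m ∸ 2 * m ≡ t * (4 * m)
2*odd*m∸2*m m t rewrite double≡2* t = trans (cong (_∸ 2 * m) (expand m t)) (m+n∸m≡n (2 * m) (t * (4 * m)))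
  where
  expand : ∀ m t → 2 * suc (2 * t) * m ≡ 2 * m + t * (4 * m)
  expand = solve-∀

lemma3p2 : (m k n : ℕ) (L : ℕ → Subset k) →
    1 ≤ m →
    n % 2 ≡ 1 →
    (∀ i → 1 ≤ i → i ≤ n → ∣ L i ∣ ≡ 4 * m) →
    2 * n * m ∸ 2 * m + ∣ hatX1 L n ∣ + ∣ hatXn L n ∣ + ∣ A L n ∣ ≤ S L n
lemma3p2 m k n L _ n-odd sizes with %2≡1⇒odd n n-odd
... | t , refl = subst (λ e → e + ∣ hatX1 L (odd t) ∣ + ∣ hatXn L (odd t) ∣ + ∣ A L (odd t) ∣ ≤ S L (odd t))
                       (sym evenSizes≡) (evenSizes+hats≤S k L t)
  where
  evenSizes≡ : 2 * odd t * m ∸ 2 * m ≡ evenSizes L t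
  evenSizes≡ = trans (2*odd*m∸2*m m t) (sym (evenSizes-const L t sizes))
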